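{- Let $n\ge 1$ and let $X$ be the set of $n^2$ squares of an $n\times n$ Bingo board, with Bingo closure as defined in the context. If $K\subseteq X$ is closed and $K\neq X$, then at least $4$ squares of $X$ are not in $K$, and at least $4$ lines are not contained in $K$.
   Context: Let $X$ be the set of $n^2$ squares of an $n\times n$ grid. A \emph{line} is one of the $n$ rows, the $n$ columns, or one of the two main diagonals (so there are $2n+2$ lines, each consisting of $n$ squares). A square $s$ is \emph{dependent} on a set $S\subseteq X$ if there is a line $L$ with $s\in L$ and $L\setminus\{s\}\subseteq S$. Let $\varphi(S)$ be the set of squares dependent on $S$. A set $K\subseteq X$ is \emph{closed} if $\varphi(K)\subseteq K$. -}

module Defs where

open import Data.Nat using (ℕ; suc; _∸_; _≤_)
open import Data.Fin using (Fin; toℕ; opposite)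
open import Data.Product using (_×_; _,_; ∃)
open import Data.Bool using (Bool; true; false)
open import Data.List using (List; length)
open import Data.List.Relation.Unary.All using (All)
open import Data.List.Relation.Unary.Unique.Propositional using (Unique)
open import Relation.Binary.PropositionalEquality using (_≡_; _≢_)

Square : ℕ → Set
Square n = Fin n × Fin n

-- The 2n+2 lines, as distinct objects (rows, columns, main diagonal, anti-diagonal).
data Line (n : ℕ) : Set where
  row  : Fin n → Line n
  col  : Fin n → Line n
  diag : Line n
  anti : Line n

_∈L_ : {n : ℕ} → Square n → Line n → Set
(i , j) ∈L row r = i ≡ r
(i , j) ∈L col c = j ≡ c
(i , j) ∈L diag  = i ≡ j
(i , j) ∈L anti  = j ≡ opposite i

Subset : ℕ → Set
Subset n = Square n → Bool

_∈_ : {n : ℕ} → Square n → Subset n → Set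
s ∈ K = K s ≡ true

_∉_ : {n : ℕ} → Square n → Subset n → Set
s ∉ K = K s ≡ false

Dependent : {n : ℕ} → Subset n → Square n → Set
Dependent {n} S s = ∃ λ (L : Line n) → s ∈L L × (∀ (t : Square n) → t ∈L L → t ≢ s → t ∈ S)

Closed : {n : ℕ} → Subset n → Set
Closed {n} K = ∀ (s : Square n) → Dependent K s → s ∈ K

_⊆L_ : {n : ℕ} → Line n → Subset n → Set
L ⊆L K = ∀ t → t ∈L L → t ∈ K

-- Closedness forbids a line with exactly one missing square. So a missing square
-- (i , j) has a second missing square (i , j') in its row, and each of (i , j) and
-- (i , j') has a further missing square (i' , j), (i'' , j') in its column. These four
-- squares are distinct, and they witness that rows i, i' and columns j, j' are not in K.
module Submission where

open import Defs
open import Data.Nat using (ℕ; _≤_; _≥_)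
open import Data.Nat.Properties using (≤-refl)
open import Data.Fin using (Fin; opposite)
open import Data.Fin.Properties using (_≟_; all?; ¬∀⟶∃¬)
open import Data.Product using (_×_; ∃; _,_; proj₁; proj₂)
open import Data.Product.Properties using (≡-dec)
open import Data.List using (List; length; []; _∷_)
open import Data.List.Relation.Unary.All using (All; []; _∷_)
open import Data.List.Relation.Unary.AllPairs using ([]; _∷_)
open import Data.List.Relation.Unary.Unique.Propositional using (Unique)
open import Data.Bool.Properties using (¬-not; not-¬)
import Data.Bool.Properties as Bool
open import Function using (_∘_)
open import Relation.Nullary using (¬_; Dec; contradiction)
open import Relation.Nullary.Decidable using (_→-dec_; ¬?; decidable-stable)
open import Relation.Unary using (Pred; Decidable)
open import Relation.Binary.PropositionalEquality using (_≡_; _≢_; refl; cong; ≢-sym)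

¬∀⟶∃¬-Square : ∀ {n p} (P : Pred (Square n) p) → Decidable P →
               ¬ (∀ s → P s) → ∃ λ s → ¬ P s
¬∀⟶∃¬-Square {n} P P? ¬∀P with ¬∀⟶∃¬ n (λ i → ∀ j → P (i , j))
                                      (λ i → all? (λ j → P? (i , j)))
                                      (λ ∀P → ¬∀P (λ (i , j) → ∀P i j))
... | i , ¬∀Pᵢ with ¬∀⟶∃¬ n (λ j → P (i , j)) (λ j → P? (i , j)) ¬∀Pᵢ
... | j , ¬Pᵢⱼ = (i , j) , ¬Pᵢⱼ

_∈L?_ : ∀ {n} (s : Square n) (L : Line n) → Dec (s ∈L L)
(i , j) ∈L? row r = i ≟ r
(i , j) ∈L? col c = j ≟ c
(i , j) ∈L? diag  = i ≟ j
(i , j) ∈L? anti  = j ≟ opposite i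

_∈?_ : ∀ {n} (s : Square n) (K : Subset n) → Dec (s ∈ K)
s ∈? K = K s Bool.≟ _

∃-∉ : ∀ {n} (K : Subset n) → ¬ (∀ s → s ∈ K) → ∃ λ s → s ∉ K
∃-∉ K K≢X with ¬∀⟶∃¬-Square (_∈ K) (_∈? K) K≢X
... | s , s∉K = s , ¬-not s∉K

∉⇒¬⊆L : ∀ {n} {K : Subset n} (L : Line n) (s : Square n) → s ∈L L → s ∉ K → ¬ (L ⊆L K)
∉⇒¬⊆L _ _ s∈L s∉K L⊆K = not-¬ (L⊆K _ s∈L) s∉K

closed⇒∃-other-∉ : ∀ {n} {K : Subset n} → Closed K → ∀ (L : Line n) {s} → s ∈L L → s ∉ K →
                   ∃ λ t → t ∈L L × t ≢ s × t ∉ K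
closed⇒∃-other-∉ {K = K} closed L {s} s∈L s∉K
  with ¬∀⟶∃¬-Square (λ t → t ∈L L → t ≢ s → t ∈ K)
                    (λ t → (t ∈L? L) →-dec (¬? (≡-dec _≟_ _≟_ t s) →-dec (t ∈? K)))
                    (λ rest⊆K → not-¬ (closed s (L , s∈L , rest⊆K)) s∉K)
... | t , ¬[t∈L→t≢s→t∈K] = t , t∈L , t≢s , ¬-not t∉K
  where
    t∈L : t ∈L L
    t∈L = decidable-stable (t ∈L? L) (λ t∉L → ¬[t∈L→t≢s→t∈K] (λ t∈L → contradiction t∈L t∉L))
    t≢s : t ≢ s
    t≢s refl = ¬[t∈L→t≢s→t∈K] (λ _ s≢s → contradiction refl s≢s)
    t∉K : ¬ (t ∈ K)
    t∉K t∈K = ¬[t∈L→t≢s→t∈K] (λ _ _ → t∈K)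

∃-other-∉-in-row : ∀ {n} {K : Subset n} → Closed K → ∀ {i j} → (i , j) ∉ K →
                   ∃ λ j′ → j ≢ j′ × (i , j′) ∉ K
∃-other-∉-in-row closed {i} ij∉K with closed⇒∃-other-∉ closed (row i) refl ij∉K
... | (_ , j′) , refl , ij′≢ij , ij′∉K = j′ , (λ { refl → ij′≢ij refl }) , ij′∉K

∃-other-∉-in-col : ∀ {n} {K : Subset n} → Closed K → ∀ {i j} → (i , j) ∉ K →
                   ∃ λ i′ → i ≢ i′ × (i′ , j) ∉ K
∃-other-∉-in-col closed {j = j} ij∉K with closed⇒∃-other-∉ closed (col j) refl ij∉K
... | (i′ , _) , refl , i′j≢ij , i′j∉K = i′ , (λ { refl → i′j≢ij refl }) , i′j∉K

module _ {n : ℕ} {i i′ j j′ : Fin n} where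

  ≢-row⇒≢ : i ≢ i′ → (i , j) ≢ (i′ , j′)
  ≢-row⇒≢ i≢i′ = i≢i′ ∘ cong proj₁

  ≢-col⇒≢ : j ≢ j′ → (i , j) ≢ (i′ , j′)
  ≢-col⇒≢ j≢j′ = j≢j′ ∘ cong proj₂

row-≢ : ∀ {n} {i i′ : Fin n} → i ≢ i′ → row i ≢ row i′
row-≢ i≢i′ refl = i≢i′ refl

col-≢ : ∀ {n} {j j′ : Fin n} → j ≢ j′ → col j ≢ col j′
col-≢ j≢j′ refl = j≢j′ refl

mainTheorem1 : (n : ℕ) → 1 ≤ n → (K : Subset n) → Closed K → ¬ (∀ s → s ∈ K) →
    (∃ λ (xs : List (Square n)) → Unique xs × All (λ s → s ∉ K) xs × length xs ≥ 4)
    × (∃ λ (ls : List (Line n)) → Unique ls × All (λ L → ¬ (L ⊆L K)) ls × length ls ≥ 4)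
mainTheorem1 n _ K closed K≢X
  with (i , j) , ij∉K ← ∃-∉ K K≢X
  with j′ , j≢j′ , ij′∉K  ← ∃-other-∉-in-row closed ij∉K
  with i′ , i≢i′ , i′j∉K  ← ∃-other-∉-in-col closed ij∉K
  with i″ , i≢i″ , i″j′∉K ← ∃-other-∉-in-col closed ij′∉K
  = ( (i , j) ∷ (i , j′) ∷ (i′ , j) ∷ (i″ , j′) ∷ []
    , (≢-col⇒≢ j≢j′ ∷ ≢-row⇒≢ i≢i′ ∷ ≢-row⇒≢ i≢i″ ∷ [])
      ∷ (≢-col⇒≢ (≢-sym j≢j′) ∷ ≢-row⇒≢ i≢i″ ∷ []) ∷ (≢-col⇒≢ j≢j′ ∷ []) ∷ [] ∷ []
    , ij∉K ∷ ij′∉K ∷ i′j∉K ∷ i″j′∉K ∷ []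
    , ≤-refl )
  , ( row i ∷ row i′ ∷ col j ∷ col j′ ∷ []
    , (row-≢ i≢i′ ∷ (λ ()) ∷ (λ ()) ∷ []) ∷ ((λ ()) ∷ (λ ()) ∷ []) ∷ (col-≢ j≢j′ ∷ []) ∷ [] ∷ []
    , ∉⇒¬⊆L (row i) (i , j) refl ij∉K ∷ ∉⇒¬⊆L (row i′) (i′ , j) refl i′j∉K
      ∷ ∉⇒¬⊆L (col j) (i , j) refl ij∉K ∷ ∉⇒¬⊆L (col j′) (i , j′) refl ij′∉K ∷ []
    , ≤-refl )
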